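{- If $T$ is a tree on at least three vertices, then $\chi_{\mu_i}(T)=\chi_\mu(T)$.
   Context: All graphs are finite and simple. A geodesic is a shortest path. For $X\subseteq V(G)$, two vertices $x,y\in X$ are $X$-visible if some $x,y$-geodesic has no internal vertex in $X$. $X$ is a mutual-visibility (MV) set if every two of its vertices are $X$-visible, and an independent mutual-visibility (IMV) set if moreover it is independent. $\chi_\mu(G)$ (resp. $\chi_{\mu_i}(G)$) is the least $k$ such that $V(G)$ can be partitioned into $k$ MV sets (resp. IMV sets). -}

module Defs where

open import Data.Nat using (ℕ; zero; suc; _≤_; _<_)
open import Data.Fin using (Fin)
open import Data.List using (List; []; _∷_; _++_; [_]; length)
open import Data.List.Relation.Unary.All using (All)
open import Data.List.Relation.Unary.Unique.Propositional using (Unique)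
open import Data.Product using (Σ; _×_; ∃)
open import Relation.Binary.PropositionalEquality using (_≡_)
open import Relation.Nullary using (¬_)
open import Data.Empty using (⊥)

record Graph (n : ℕ) : Set₁ where
  field
    Adj     : Fin n → Fin n → Set
    sym     : ∀ {x y} → Adj x y → Adj y x
    irrefl  : ∀ {x} → ¬ Adj x x
open Graph public

module _ {n : ℕ} (G : Graph n) where

  data Walk : Fin n → Fin n → Set where
    here : ∀ x → Walk x x
    step : ∀ {x y z} → Adj G x y → Walk y z → Walk x z

  walkLength : ∀ {x y} → Walk x y → ℕ
  walkLength (here _)   = zero
  walkLength (step _ w) = suc (walkLength w)

  inner : ∀ {x y} → Walk x y → List (Fin n)
  inner (here _) = []
  inner (step _ (here _)) = []
  inner (step {y = y} _ w@(step _ _)) = y ∷ inner w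

  IsGeodesic : ∀ {x y} → Walk x y → Set
  IsGeodesic {x} {y} w = ∀ (w' : Walk x y) → walkLength w ≤ walkLength w'

  Connected : Set
  Connected = ∀ x y → Walk x y

  data Chain : List (Fin n) → Set where
    nil  : Chain []
    one  : ∀ x → Chain (x ∷ [])
    cons : ∀ {x y vs} → Adj G x y → Chain (y ∷ vs) → Chain (x ∷ y ∷ vs)

  -- A cycle: distinct vertices v ∷ ws (at least 3) with v,ws...,v a closed walk.
  HasCycle : Set
  HasCycle = Σ (Fin n) λ v → Σ (List (Fin n)) λ ws →
               (2 ≤ length ws) × Unique (v ∷ ws) × Chain (v ∷ ws ++ [ v ])

  IsTree : Set
  IsTree = Connected × ¬ HasCycle

  Visible : (Fin n → Set) → Fin n → Fin n → Set
  Visible X x y = Σ (Walk x y) λ w → IsGeodesic w × All (λ v → ¬ X v) (inner w)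

  IsMV : (Fin n → Set) → Set
  IsMV X = ∀ x y → X x → X y → Visible X x y

  Independent : (Fin n → Set) → Set
  Independent X = ∀ x y → X x → X y → ¬ Adj G x y

  IsIMV : (Fin n → Set) → Set
  IsIMV X = Independent X × IsMV X

  Class : ∀ {k} → (Fin n → Fin k) → Fin k → Fin n → Set
  Class c i v = c v ≡ i

  -- V(G) can be partitioned into k sets each satisfying P
  -- (given by a colouring c : V → Fin k; classes may be empty, which does
  -- not affect the minimum).
  PartitionInto : (P : (Fin n → Set) → Set) → ℕ → Set
  PartitionInto P k = Σ (Fin n → Fin k) λ c → ∀ i → P (Class c i)

  IsLeast : ((Fin n → Set) → Set) → ℕ → Set
  IsLeast P k = PartitionInto P k × (∀ m → m < k → ¬ PartitionInto P m)

  IsChiMu : ℕ → Set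
  IsChiMu = IsLeast IsMV

  IsChiMuI : ℕ → Set
  IsChiMuI = IsLeast IsIMV

{-# OPTIONS --safe #-}
module Submission where

-- In a tree a set is mutual-visibility iff none of its vertices lies on the path between two
-- others, so an MV colour class containing an edge uv is exactly {u, v}. Such a class is repaired
-- together with the class C of some third vertex. If C has vertices p ≠ q with p on v's side of
-- uv and on the path from v to q, then all of C lies beyond p as seen from v, and {u, p} and
-- {v} ∪ C ∖ {p} are independent MV sets; symmetrically with u and v exchanged. Otherwise
-- {u} ∪ (C on v's side) and {v} ∪ (C on u's side) are. The repair keeps every class MV and only
-- shrinks the classes not involved, so fixing the classes one at a time turns an MV colouring
-- into an IMV colouring with the same number of colours; the other inequality is immediate.

open import Defs renaming (sym to adj-sym; irrefl to adj-irrefl)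
open import Data.Nat using (ℕ; zero; suc; _≤_; _<_; _+_; z≤n; s≤s; s≤s⁻¹)
open import Data.Nat.Properties
open import Data.Fin using (Fin; zero; suc; toℕ; fromℕ<) renaming (_≟_ to _≟ᶠ_)
open import Data.Fin.Properties using (any?; toℕ<n; toℕ-injective; toℕ-fromℕ<)
open import Data.List using (List; []; _∷_; _++_; length)
open import Data.List.Relation.Unary.All as All using ([]; _∷_; lookup; tabulate)
open import Data.List.Relation.Unary.All.Properties using (¬Any⇒All¬; anti-mono)
open import Data.List.Relation.Unary.Any using (here; there)
open import Data.List.Relation.Unary.Unique.Propositional using (Unique; []; _∷_)
open import Data.List.Relation.Unary.Unique.Propositional.Properties using (Unique[x∷xs]⇒x∉xs; ++⁺)
open import Data.List.Relation.Binary.Disjoint.Propositional using (Disjoint)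
open import Data.List.Relation.Binary.Subset.Propositional using (_⊆_)
open import Data.List.Membership.Propositional using (_∈_; _∉_)
open import Data.Product using (Σ; _×_; _,_; proj₁; proj₂)
import Data.Product
open import Data.Sum using (_⊎_; inj₁; inj₂; [_,_])
open import Data.Empty using (⊥-elim)
open import Function using (_∘_; id)
open import Relation.Unary using (Decidable)
open import Relation.Nullary using (¬_; yes; no; Dec; ¬?; _×-dec_; _⊎-dec_)
open import Relation.Binary.PropositionalEquality
  using (_≡_; _≢_; refl; sym; cong; cong₂; trans; subst; module ≡-Reasoning)

module Walks {n : ℕ} (G : Graph n) where
  open import Data.List.Membership.DecPropositional (_≟ᶠ_ {n}) using (_∈?_)

  private
    variable
      x y y′ z : Fin n

  adj⇒≢ : Adj G x y → x ≢ y
  adj⇒≢ xy refl = adj-irrefl G xy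

  len : Walk G x y → ℕ
  len = walkLength G

  walk-nonempty : (p : Walk G x y) → x ≢ y → 1 ≤ len p
  walk-nonempty (here _)   x≢y = ⊥-elim (x≢y refl)
  walk-nonempty (step _ _) _   = s≤s z≤n

  verts : Walk G x y → List (Fin n)
  verts (here x)       = x ∷ []
  verts (step {x} _ p) = x ∷ verts p

  IsPath : Walk G x y → Set
  IsPath p = Unique (verts p)

  _++ʷ_ : Walk G x y → Walk G y z → Walk G x z
  here _   ++ʷ q = q
  step a p ++ʷ q = step a (p ++ʷ q)

  length-++ʷ : (p : Walk G x y) (q : Walk G y z) → len (p ++ʷ q) ≡ len p + len q
  length-++ʷ (here _)   q = refl
  length-++ʷ (step a p) q = cong suc (length-++ʷ p q)

  verts-++ʷ-step : (p : Walk G x y) (a : Adj G y y′) (q : Walk G y′ z) →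
                   verts (p ++ʷ step a q) ≡ verts p ++ verts q
  verts-++ʷ-step (here _)   a q = refl
  verts-++ʷ-step (step b p) a q = cong (_ ∷_) (verts-++ʷ-step p a q)

  head∈verts : (p : Walk G x y) → x ∈ verts p
  head∈verts (here _)   = here refl
  head∈verts (step _ _) = here refl

  verts-⊆-++ʷ : (p : Walk G x y) (q : Walk G y z) → verts p ⊆ verts (p ++ʷ q)
  verts-⊆-++ʷ (here _)   q (here refl) = head∈verts q
  verts-⊆-++ʷ (step a p) q (here refl) = here refl
  verts-⊆-++ʷ (step a p) q (there m)   = there (verts-⊆-++ʷ p q m)

  junction∈verts : (p : Walk G x y) (q : Walk G y z) → y ∈ verts (p ++ʷ q)
  junction∈verts (here _)   q = head∈verts q
  junction∈verts (step a p) q = there (junction∈verts p q)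

  last∈verts : (p : Walk G x y) → y ∈ verts p
  last∈verts (here _)   = here refl
  last∈verts (step _ p) = there (last∈verts p)

  split : (p : Walk G x y) → z ∈ verts p →
          Σ (Walk G x z) λ q₁ → Σ (Walk G z y) λ q₂ → p ≡ q₁ ++ʷ q₂
  split (here x)   (here refl) = here x , here x , refl
  split (step a p) (here refl) = here _ , step a p , refl
  split (step a p) (there m) with split p m
  ... | q₁ , q₂ , refl = step a q₁ , q₂ , refl

  reverse : Walk G x y → Walk G y x
  reverse (here x)   = here x
  reverse (step a p) = reverse p ++ʷ step (adj-sym G a) (here _)

  length-reverse : (p : Walk G x y) → len (reverse p) ≡ len p
  length-reverse (here x)   = refl
  length-reverse (step a p) =
    trans (length-++ʷ (reverse p) _) (trans (+-comm (len (reverse p)) 1) (cong suc (length-reverse p)))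

  path-suffix : (p : Walk G x y) (q : Walk G y z) → IsPath (p ++ʷ q) → IsPath q
  path-suffix (here _)   q pq-path       = pq-path
  path-suffix (step a p) q (_ ∷ pq-path) = path-suffix p q pq-path

  path-prefix : (p : Walk G x y) (q : Walk G y z) → IsPath (p ++ʷ q) → IsPath p
  path-prefix (here _)   q _                  = [] ∷ []
  path-prefix (step a p) q (x∉pq ∷ pq-path) =
    anti-mono (verts-⊆-++ʷ p q) x∉pq ∷ path-prefix p q pq-path

  toPath : Walk G x y → Σ (Walk G x y) IsPath
  toPath (here x) = here x , [] ∷ []
  toPath (step {x} a w) with toPath w
  ... | p , p-path with x ∈? verts p
  ...   | no x∉p = step a p , ¬Any⇒All¬ _ x∉p ∷ p-path
  ...   | yes x∈p with split p x∈p
  ...     | q₁ , q₂ , refl = q₂ , path-suffix q₁ q₂ p-path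

  geodesic⇒path : (p : Walk G x y) → IsGeodesic G p → IsPath p
  geodesic⇒path (here x)       _        = [] ∷ []
  geodesic⇒path (step {x} a p) shortest =
    ¬Any⇒All¬ _ x∉p ∷ geodesic⇒path p (λ p′ → ≤-pred (shortest (step a p′)))
    where
      x∉p : x ∉ verts p
      x∉p x∈p with split p x∈p
      ... | q₁ , q₂ , refl = 1+n≰n (begin
        suc (len q₂)               ≤⟨ s≤s (m≤n+m (len q₂) (len q₁)) ⟩
        suc (len q₁ + len q₂)      ≡⟨ cong suc (length-++ʷ q₁ q₂) ⟨
        suc (len (q₁ ++ʷ q₂))      ≤⟨ shortest q₂ ⟩
        len q₂                     ∎)
        where open ≤-Reasoning

  inner⊆verts : (p : Walk G x y) → inner G p ⊆ verts p
  inner⊆verts (step _ (step _ p))   (here refl) = there (here refl)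
  inner⊆verts (step _ p@(step _ _)) (there m)   = there (inner⊆verts p m)

  path-inner≢ends : (p : Walk G x y) → IsPath p → z ∈ inner G p → z ≢ x × z ≢ y
  path-inner≢ends (step a (step b p)) (x∉ ∷ x₁∉ ∷ _) (here refl) =
    (λ z≡x → lookup x∉ (here refl) (sym z≡x)) , (λ z≡y → lookup x₁∉ (last∈verts p) z≡y)
  path-inner≢ends (step a p@(step b _)) (x∉ ∷ p-path) (there m) =
    (λ z≡x → lookup x∉ (inner⊆verts p m) (sym z≡x)) , proj₂ (path-inner≢ends p p-path m)

  verts-head-or-inner : (p : Walk G x y) → z ∈ verts p → z ≢ y → z ≡ x ⊎ z ∈ inner G p
  verts-head-or-inner (here _)              (here refl)         _   = inj₁ refl
  verts-head-or-inner (step _ _)            (here refl)         _   = inj₁ refl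
  verts-head-or-inner (step _ (here _))     (there (here refl)) z≢y = ⊥-elim (z≢y refl)
  verts-head-or-inner (step _ p@(step _ _)) (there m)           z≢y =
    inj₂ ([ (λ { refl → here refl }) , there ] (verts-head-or-inner p m z≢y))

  non-endpoint⇒inner : (p : Walk G x y) → z ∈ verts p → z ≢ x → z ≢ y → z ∈ inner G p
  non-endpoint⇒inner p m z≢x z≢y = [ ⊥-elim ∘ z≢x , id ] (verts-head-or-inner p m z≢y)

  length-verts : (p : Walk G x y) → length (verts p) ≡ suc (len p)
  length-verts (here _)   = refl
  length-verts (step _ p) = cong suc (length-verts p)

  chain-snoc : (p : Walk G x y) → Adj G y z → Chain G (verts p ++ z ∷ [])
  chain-snoc (here _)              b = cons b (one _)
  chain-snoc (step a p@(here _))   b = cons a (chain-snoc p b)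
  chain-snoc (step a p@(step _ _)) b = cons a (chain-snoc p b)

  path+edge⇒cycle : (p : Walk G x y) → IsPath p → 2 ≤ len p → Adj G y x → HasCycle G
  path+edge⇒cycle (step {x} a p) p-path 2≤len b =
    x , verts p , subst (2 ≤_) (sym (length-verts p)) 2≤len , p-path , chain-snoc (step a p) b

record Repair {n l} (G : Graph n) (c : Fin n → Fin l) (i j : Fin l) : Set where
  field
    colouring    : Fin n → Fin l
    class-i-IMV  : IsIMV G (Class G colouring i)
    class-j-IMV  : IsIMV G (Class G colouring j)
    other-classes-shrink : ∀ {k x} → k ≢ i → k ≢ j → colouring x ≡ k → c x ≡ k

module _ {n} (G : Graph n) where
  private
    variable
      X Y : Fin n → Set

  IsMV-⊆ : (∀ {x} → X x → Y x) → IsMV G Y → IsMV G X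
  IsMV-⊆ X⊆Y Y-mv x y Xx Xy =
    let g , g-geodesic , g-avoids-Y = Y-mv x y (X⊆Y Xx) (X⊆Y Xy) in
    g , g-geodesic , All.map (_∘ X⊆Y) g-avoids-Y

  Independent-⊆ : (∀ {x} → X x → Y x) → Independent G Y → Independent G X
  Independent-⊆ X⊆Y Y-indep x y Xx Xy = Y-indep x y (X⊆Y Xx) (X⊆Y Xy)

  IsIMV-⊆ : (∀ {x} → X x → Y x) → IsIMV G Y → IsIMV G X
  IsIMV-⊆ X⊆Y = Data.Product.map (Independent-⊆ X⊆Y) (IsMV-⊆ X⊆Y)

module Recolouring {n l} (G : Graph n) (c : Fin n → Fin l) {i j : Fin l} (i≢j : i ≢ j)
                   {P Q : Fin n → Set} (P? : Decidable P) (Q? : Decidable Q)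
                   (covers : ∀ {x} → c x ≡ i ⊎ c x ≡ j → P x ⊎ Q x) where

  recolour : Fin n → Fin l
  recolour x with P? x | Q? x
  ... | yes _ | _     = i
  ... | no _  | yes _ = j
  ... | no _  | no _  = c x

  recolour-i : ∀ {x} → recolour x ≡ i → P x
  recolour-i {x} eq with P? x | Q? x
  ... | yes Px | _      = Px
  ... | no _   | yes _  = ⊥-elim (i≢j (sym eq))
  ... | no ¬Px | no ¬Qx = ⊥-elim ([ ¬Px , ¬Qx ] (covers (inj₁ eq)))

  recolour-j : ∀ {x} → recolour x ≡ j → Q x
  recolour-j {x} eq with P? x | Q? x
  ... | yes _  | _      = ⊥-elim (i≢j eq)
  ... | no _   | yes Qx = Qx
  ... | no ¬Px | no ¬Qx = ⊥-elim ([ ¬Px , ¬Qx ] (covers (inj₂ eq)))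

  recolour-other : ∀ {k x} → k ≢ i → k ≢ j → recolour x ≡ k → c x ≡ k
  recolour-other {x = x} k≢i k≢j eq with P? x | Q? x
  ... | yes _ | _     = ⊥-elim (k≢i (sym eq))
  ... | no _  | yes _ = ⊥-elim (k≢j (sym eq))
  ... | no _  | no _  = eq

  repair : IsIMV G P → IsIMV G Q → Repair G c i j
  repair P-imv Q-imv = record
    { colouring            = recolour
    ; class-i-IMV          = IsIMV-⊆ G recolour-i P-imv
    ; class-j-IMV          = IsIMV-⊆ G recolour-j Q-imv
    ; other-classes-shrink = recolour-other
    }

∃-avoiding-two : ∀ {n} → 3 ≤ n → (u v : Fin n) → Σ (Fin n) λ w → w ≢ u × w ≢ v
∃-avoiding-two (s≤s (s≤s (s≤s _))) zero          zero          = suc zero , (λ ()) , (λ ())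
∃-avoiding-two (s≤s (s≤s (s≤s _))) zero          (suc zero)    = suc (suc zero) , (λ ()) , (λ ())
∃-avoiding-two (s≤s (s≤s (s≤s _))) zero          (suc (suc _)) = suc zero , (λ ()) , (λ ())
∃-avoiding-two (s≤s (s≤s (s≤s _))) (suc zero)    zero          = suc (suc zero) , (λ ()) , (λ ())
∃-avoiding-two (s≤s (s≤s (s≤s _))) (suc zero)    (suc _)       = zero , (λ ()) , (λ ())
∃-avoiding-two (s≤s (s≤s (s≤s _))) (suc (suc _)) zero          = suc zero , (λ ()) , (λ ())
∃-avoiding-two (s≤s (s≤s (s≤s _))) (suc (suc _)) (suc _)       = zero , (λ ()) , (λ ())

module TreeMetric {n : ℕ} (G : Graph n) (connected : Connected G) (acyclic : ¬ HasCycle G) where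
  open Walks G
  open import Data.List.Membership.DecPropositional (_≟ᶠ_ {n}) using (_∈?_)

  private
    V = Fin n
    variable
      a c c′ e u v w x y y′ z : V
      X : V → Set

  -- If the path and the walk leave x through different neighbours x₂ and x₁, then x₁ is not on the
  -- path (the path up to x₁ and the edge x₁x would form a cycle), so the path extended backwards
  -- by the edge x₁x can be compared with the rest of the walk.
  path-within-walk : (w p : Walk G x y) → IsPath p → len p ≤ len w × verts p ⊆ verts w
  path-within-walk (here _)   (here _)   _      = z≤n , id
  path-within-walk (here _)   (step _ p) p-path = ⊥-elim (Unique[x∷xs]⇒x∉xs p-path (last∈verts p))
  path-within-walk (step _ _) (here _)   _      = z≤n , λ { (here refl) → here refl }
  path-within-walk (step {y = x₁} a w) (step {y = x₂} b p) p-path@(_ ∷ tail-path) with x₂ ≟ᶠ x₁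
  ... | yes refl = s≤s (proj₁ ih) , λ { (here refl) → here refl ; (there m) → there (proj₂ ih m) }
    where ih = path-within-walk w p tail-path
  ... | no x₂≢x₁ with x₁ ∈? verts p
  ...   | yes x₁∈p with split p x₁∈p
  ...     | q₁ , q₂ , refl = ⊥-elim (acyclic (path+edge⇒cycle (step b q₁)
              (path-prefix (step b q₁) q₂ p-path) (s≤s (walk-nonempty q₁ x₂≢x₁)) (adj-sym G a)))
  path-within-walk {x} (step {y = x₁} a w) (step b p) p-path | no _ | no x₁∉p =
    m<n⇒m≤1+n (proj₁ ih) , there ∘ proj₂ ih ∘ there
    where
      x₁∉bp : x₁ ∉ x ∷ verts p
      x₁∉bp (here x₁≡x)  = adj⇒≢ a (sym x₁≡x)
      x₁∉bp (there x₁∈p) = x₁∉p x₁∈p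
      ih = path-within-walk w (step (adj-sym G a) (step b p)) (¬Any⇒All¬ _ x₁∉bp ∷ p-path)

  path⇒geodesic : (p : Walk G x y) → IsPath p → IsGeodesic G p
  path⇒geodesic p p-path w = proj₁ (path-within-walk w p p-path)

  geodesic : ∀ x y → Walk G x y
  geodesic x y = proj₁ (toPath (connected x y))

  geodesic-isPath : ∀ x y → IsPath (geodesic x y)
  geodesic-isPath x y = proj₂ (toPath (connected x y))

  dist : V → V → ℕ
  dist x y = len (geodesic x y)

  dist-minimal : (w : Walk G x y) → dist x y ≤ len w
  dist-minimal = path⇒geodesic (geodesic _ _) (geodesic-isPath _ _)

  path-length : (p : Walk G x y) → IsPath p → len p ≡ dist x y
  path-length p p-path = ≤-antisym (path⇒geodesic p p-path (geodesic _ _)) (dist-minimal p)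

  dist-triangle : ∀ x y z → dist x z ≤ dist x y + dist y z
  dist-triangle x y z = subst (dist x z ≤_) (length-++ʷ (geodesic x y) (geodesic y z))
                               (dist-minimal (geodesic x y ++ʷ geodesic y z))

  dist-sym : ∀ x y → dist x y ≡ dist y x
  dist-sym x y = ≤-antisym (sym-≤ x y) (sym-≤ y x)
    where
      sym-≤ : ∀ x y → dist x y ≤ dist y x
      sym-≤ x y = subst (dist x y ≤_) (length-reverse (geodesic y x))
                        (dist-minimal (reverse (geodesic y x)))

  dist-refl : ∀ x → dist x x ≡ 0
  dist-refl x = sym (path-length (here x) ([] ∷ []))

  dist≡0⇒≡ : dist x y ≡ 0 → x ≡ y
  dist≡0⇒≡ {x} {y} = walk-length≡0 (geodesic x y)
    where
      walk-length≡0 : (p : Walk G x y) → len p ≡ 0 → x ≡ y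
      walk-length≡0 (here _) _ = refl

  adj⇒dist≡1 : Adj G x y → dist x y ≡ 1
  adj⇒dist≡1 {y = y} xy = sym (path-length (step xy (here y)) ((adj⇒≢ xy ∷ []) ∷ [] ∷ []))

  dist≡1⇒adj : dist x y ≡ 1 → Adj G x y
  dist≡1⇒adj {x} {y} = walk-length≡1 (geodesic x y)
    where
      walk-length≡1 : (p : Walk G x y) → len p ≡ 1 → Adj G x y
      walk-length≡1 (step a (here _))   _ = a
      walk-length≡1 (step a (step _ _)) ()

  Between : V → V → V → Set
  Between x z y = dist x z + dist z y ≡ dist x y

  between-sym : Between x z y → Between y z x
  between-sym {x} {z} {y} xzy = begin
    dist y z + dist z x ≡⟨ cong₂ _+_ (dist-sym y z) (dist-sym z x) ⟩
    dist z y + dist x z ≡⟨ +-comm (dist z y) (dist x z) ⟩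
    dist x z + dist z y ≡⟨ xzy ⟩
    dist x y            ≡⟨ dist-sym x y ⟩
    dist y x            ∎
    where open ≡-Reasoning

  between-self : Between x z x → z ≡ x
  between-self {x} {z} xzx = sym (dist≡0⇒≡ (m+n≡0⇒m≡0 (dist x z) (trans xzx (dist-refl x))))

  shortest-walk⇒between : (w : Walk G x y) → len w ≡ dist x y → z ∈ verts w → Between x z y
  shortest-walk⇒between {x} {y} {z} w w-shortest z∈w with split w z∈w
  ... | q₁ , q₂ , refl = ≤-antisym (begin
    dist x z + dist z y  ≤⟨ +-mono-≤ (dist-minimal q₁) (dist-minimal q₂) ⟩
    len q₁ + len q₂      ≡⟨ length-++ʷ q₁ q₂ ⟨
    len (q₁ ++ʷ q₂)      ≡⟨ w-shortest ⟩
    dist x y             ∎)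
    (dist-triangle x z y)
    where open ≤-Reasoning

  between⇒∈-every-walk : Between x z y → (w : Walk G x y) → z ∈ verts w
  between⇒∈-every-walk {x} {z} {y} xzy w =
    proj₂ (path-within-walk w h h-path) (junction∈verts (geodesic x z) (geodesic z y))
    where
      h = geodesic x z ++ʷ geodesic z y
      h-length : len h ≡ dist x y
      h-length = trans (length-++ʷ (geodesic x z) (geodesic z y)) xzy
      h-path : IsPath h
      h-path = geodesic⇒path h λ w′ → subst (_≤ len w′) (sym h-length) (dist-minimal w′)

  BetweenFree : (V → Set) → Set
  BetweenFree X = ∀ {x y z} → X x → X y → X z → Between x z y → z ≡ x ⊎ z ≡ y

  betweenFree⇒IsMV : BetweenFree X → IsMV G X
  betweenFree⇒IsMV X-free x y Xx Xy = geodesic x y , dist-minimal , tabulate λ z∈ Xz →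
    let z≢x , z≢y = path-inner≢ends (geodesic x y) (geodesic-isPath x y) z∈ in
    [ z≢x , z≢y ] (X-free Xx Xy Xz (shortest-walk⇒between (geodesic x y) refl (inner⊆verts _ z∈)))

  IsMV⇒betweenFree : IsMV G X → BetweenFree X
  IsMV⇒betweenFree X-mv {x} {y} {z} Xx Xy Xz xzy with z ≟ᶠ x | z ≟ᶠ y
  ... | yes z≡x | _       = inj₁ z≡x
  ... | no _    | yes z≡y = inj₂ z≡y
  ... | no z≢x  | no z≢y  with X-mv x y Xx Xy
  ...   | g , _ , g-avoids-X =
    ⊥-elim (lookup g-avoids-X (non-endpoint⇒inner g (between⇒∈-every-walk xzy g) z≢x z≢y) Xz)

  Nearer : V → V → V → Set
  Nearer y y′ x = dist x y′ ≡ suc (dist x y)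

  nearer-sym : Nearer y y′ x → dist y′ x ≡ suc (dist y x)
  nearer-sym {y} {y′} {x} x-near = trans (dist-sym y′ x) (trans x-near (cong suc (dist-sym x y)))

  edge-sides : Adj G u v → ∀ x → Nearer u v x ⊎ Nearer v u x
  edge-sides {u} {v} uv x with u ∈? verts (geodesic v x)
  ... | yes u∈vx = inj₁ (begin
    dist x v             ≡⟨ dist-sym x v ⟩
    dist v x             ≡⟨ shortest-walk⇒between (geodesic v x) refl u∈vx ⟨
    dist v u + dist u x  ≡⟨ cong₂ _+_ (adj⇒dist≡1 (adj-sym G uv)) (dist-sym u x) ⟩
    suc (dist x u)       ∎)
    where open ≡-Reasoning
  ... | no u∉vx = inj₂ (begin
    dist x u             ≡⟨ dist-sym x u ⟩
    dist u x             ≡⟨ path-length (step uv (geodesic v x)) u-vx-path ⟨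
    suc (dist v x)       ≡⟨ cong suc (dist-sym v x) ⟩
    suc (dist x v)       ∎)
    where
      open ≡-Reasoning
      u-vx-path : IsPath (step uv (geodesic v x))
      u-vx-path = ¬Any⇒All¬ _ u∉vx ∷ geodesic-isPath v x

  between-nearer : Nearer y y′ x → Between x w y → ¬ Nearer y′ y w
  between-nearer {y} {y′} {x} {w} x-near xwy w-near = <-irrefl refl (begin-strict
    dist x w + dist w y′        <⟨ n<1+n _ ⟩
    suc (dist x w + dist w y′)  ≡⟨ +-suc (dist x w) (dist w y′) ⟨
    dist x w + suc (dist w y′)  ≡⟨ cong (dist x w +_) w-near ⟨
    dist x w + dist w y         ≡⟨ xwy ⟩
    dist x y                    <⟨ n<1+n _ ⟩
    suc (dist x y)              ≡⟨ x-near ⟨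
    dist x y′                   ≤⟨ dist-triangle x w y′ ⟩
    dist x w + dist w y′        ∎)
    where open ≤-Reasoning

  nearer-not-between : Nearer a c′ v → Nearer a c′ c → ¬ Between v c′ c
  nearer-not-between {a} {c′} {v} {c} v-near c-near vc′c = <-irrefl refl (begin-strict
    dist v c                         ≤⟨ dist-triangle v a c ⟩
    dist v a + dist a c              <⟨ +-mono-< (n<1+n _) (n<1+n _) ⟩
    suc (dist v a) + suc (dist a c)  ≡⟨ cong₂ _+_ v-near (nearer-sym c-near) ⟨
    dist v c′ + dist c′ c            ≡⟨ vc′c ⟩
    dist v c                         ∎)
    where open ≤-Reasoning

  gluing : Adj G y y′ → Nearer y y′ x → Nearer y′ y z → dist x z ≡ dist x y + suc (dist y′ z)
  gluing {y} {y′} {x} {z} yy′ x-near z-near =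
    trans (sym (path-length (p ++ʷ step yy′ q) pq-path)) (length-++ʷ p (step yy′ q))
    where
      p = geodesic x y
      q = geodesic y′ z
      disjoint : Disjoint (verts p) (verts q)
      disjoint {w} (w∈p , w∈q) =
        [ between-nearer z-near (between-sym (shortest-walk⇒between q refl w∈q))
        , between-nearer x-near (shortest-walk⇒between p refl w∈p) ] (edge-sides yy′ w)
      pq-path : IsPath (p ++ʷ step yy′ q)
      pq-path = subst Unique (sym (verts-++ʷ-step p yy′ q))
                  (++⁺ (geodesic-isPath x y) (geodesic-isPath y′ z) disjoint)

  neighbour-towards : x ≢ y → Σ V λ a → Adj G a y × Nearer a y x
  neighbour-towards {x} {y} x≢y = first-edge (geodesic y x) (geodesic-isPath y x)
    where
      first-edge : (p : Walk G y x) → IsPath p → Σ V λ a → Adj G a y × Nearer a y x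
      first-edge (here _) _ = ⊥-elim (x≢y refl)
      first-edge p@(step {y = a} ya rest) p-path@(_ ∷ rest-path) = a , adj-sym G ya , (begin
        dist x y          ≡⟨ dist-sym x y ⟩
        dist y x          ≡⟨ path-length p p-path ⟨
        suc (len rest)    ≡⟨ cong suc (path-length rest rest-path) ⟩
        suc (dist a x)    ≡⟨ cong suc (dist-sym a x) ⟩
        suc (dist x a)    ∎)
        where open ≡-Reasoning

  median : v ≢ c′ → Between v c′ c → ¬ Between v c′ e → Between c c′ e
  median {v} {c′} {c} {e} v≢c′ vc′c ¬vc′e with neighbour-towards v≢c′
  ... | a , ac′ , v-near with edge-sides ac′ e
  ...   | inj₂ e-near = ⊥-elim (¬vc′e (begin
    dist v c′ + dist c′ e        ≡⟨ cong (_+ dist c′ e) v-near ⟩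
    suc (dist v a) + dist c′ e   ≡⟨ +-suc (dist v a) (dist c′ e) ⟨
    dist v a + suc (dist c′ e)   ≡⟨ gluing ac′ v-near e-near ⟨
    dist v e                     ∎))
    where open ≡-Reasoning
  ...   | inj₁ e-near with edge-sides ac′ c
  ...     | inj₁ c-near = ⊥-elim (nearer-not-between v-near c-near vc′c)
  ...     | inj₂ c-near = begin
    dist c c′ + dist c′ e        ≡⟨ cong (dist c c′ +_) (nearer-sym e-near) ⟩
    dist c c′ + suc (dist a e)   ≡⟨ gluing (adj-sym G ac′) c-near e-near ⟨
    dist c e                     ∎
    where open ≡-Reasoning

  edge-between : Adj G y y′ → Nearer y y′ x → Between y′ y x
  edge-between {y} {y′} {x} yy′ x-near =
    trans (cong (_+ dist y x) (adj⇒dist≡1 (adj-sym G yy′))) (sym (nearer-sym x-near))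

  between-adjacent : Adj G x y → Between x z y → z ≡ x ⊎ z ≡ y
  between-adjacent {x} {y} {z} xy xzy with dist x z in eq
  ... | zero  = inj₁ (sym (dist≡0⇒≡ eq))
  ... | suc m = inj₂ (dist≡0⇒≡ (m+n≡0⇒n≡0 m (suc-injective (trans xzy (adj⇒dist≡1 xy)))))

  not-between-beyond : v ≢ a → Between v a x → Between v a y → ¬ Between x v y
  not-between-beyond {v} {a} {x} {y} v≢a vax vay xvy = <-irrefl refl (begin-strict
    dist x y                                 ≤⟨ dist-triangle x a y ⟩
    dist x a + dist a y                      ≡⟨ cong (_+ dist a y) (dist-sym x a) ⟩
    dist a x + dist a y                      <⟨ +-mono-<-≤ (m<n+m _ 0<dva) (m≤n+m _ _) ⟩
    (dist v a + dist a x) + (dist v a + dist a y) ≡⟨ cong₂ _+_ vax vay ⟩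
    dist v x + dist v y                      ≡⟨ cong (_+ dist v y) (dist-sym v x) ⟩
    dist x v + dist v y                      ≡⟨ xvy ⟩
    dist x y                                 ∎)
    where
      open ≤-Reasoning
      0<dva : 0 < dist v a
      0<dva = n≢0⇒n>0 (v≢a ∘ dist≡0⇒≡)

  betweenFree-edge : BetweenFree X → Adj G u v → X u → X v → X x → x ≡ u ⊎ x ≡ v
  betweenFree-edge {x = x} X-free uv Xu Xv Xx with edge-sides uv x
  ... | inj₁ x-near = [ inj₁ ∘ sym , ⊥-elim ∘ adj⇒≢ uv ]
                        (X-free Xx Xv Xu (between-sym (edge-between uv x-near)))
  ... | inj₂ x-near = [ inj₂ ∘ sym , ⊥-elim ∘ adj⇒≢ uv ∘ sym ]
                        (X-free Xx Xu Xv (between-sym (edge-between (adj-sym G uv) x-near)))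

  betweenFree-insert : ∀ {D} → BetweenFree D →
                       (∀ {x y} → D x → D y → ¬ Between x w y) →
                       (∀ {z y} → D z → D y → Between w z y → z ≡ y) →
                       BetweenFree (λ x → x ≡ w ⊎ D x)
  betweenFree-insert _      _     _     (inj₁ refl) _           (inj₁ refl) _   = inj₁ refl
  betweenFree-insert _      _     _     _           (inj₁ refl) (inj₁ refl) _   = inj₂ refl
  betweenFree-insert _      w-out _     (inj₂ Dx)   (inj₂ Dy)   (inj₁ refl) xwy = ⊥-elim (w-out Dx Dy xwy)
  betweenFree-insert _      _     _     (inj₁ refl) (inj₁ refl) (inj₂ _)    xzx = inj₁ (between-self xzx)
  betweenFree-insert _      _     after (inj₁ refl) (inj₂ Dy)   (inj₂ Dz)   wzy = inj₂ (after Dz Dy wzy)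
  betweenFree-insert _      _     after (inj₂ Dx)   (inj₁ refl) (inj₂ Dz)   xzw = inj₁ (after Dz Dx (between-sym xzw))
  betweenFree-insert D-free _     _     (inj₂ Dx)   (inj₂ Dy)   (inj₂ Dz)   xzy = D-free Dx Dy Dz xzy

  pair-betweenFree : BetweenFree (λ x → x ≡ a ⊎ x ≡ c)
  pair-betweenFree (inj₁ refl) _           (inj₁ refl) _   = inj₁ refl
  pair-betweenFree (inj₂ refl) _           (inj₂ refl) _   = inj₁ refl
  pair-betweenFree _           (inj₁ refl) (inj₁ refl) _   = inj₂ refl
  pair-betweenFree _           (inj₂ refl) (inj₂ refl) _   = inj₂ refl
  pair-betweenFree (inj₂ refl) (inj₂ refl) (inj₁ refl) xzx = inj₁ (between-self xzx)
  pair-betweenFree (inj₁ refl) (inj₁ refl) (inj₂ refl) xzx = inj₁ (between-self xzx)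

  independent-insert : ∀ {D} → Independent G D → (∀ {y} → D y → ¬ Adj G w y) →
                       Independent G (λ x → x ≡ w ⊎ D x)
  independent-insert D-indep w-apart _ _ (inj₁ refl) (inj₁ refl) = adj-irrefl G
  independent-insert D-indep w-apart _ _ (inj₁ refl) (inj₂ Dy)   = w-apart Dy
  independent-insert D-indep w-apart _ _ (inj₂ Dx)   (inj₁ refl) = w-apart Dx ∘ adj-sym G
  independent-insert D-indep w-apart x y (inj₂ Dx)   (inj₂ Dy)   = D-indep x y Dx Dy

  Stacked : V → V → (V → Set) → Set
  Stacked u v C = Σ V λ p → Σ V λ q → C p × C q × Nearer v u p × p ≢ q × Between v p q

  module _ {u v} {C : V → Set} (uv : Adj G u v) (C-free : BetweenFree C) (v∉C : ¬ C v) where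

    not-adj-across : C y → Nearer v u y → ¬ Adj G u y
    not-adj-across Cy y-near uy =
      [ adj⇒≢ uv ∘ sym , (λ { refl → v∉C Cy }) ]
        (between-adjacent uy (edge-between (adj-sym G uv) y-near))

    nearer-part-IMV : ¬ Stacked u v C → IsIMV G (λ x → x ≡ u ⊎ (C x × Nearer v u x))
    nearer-part-IMV unstacked =
      independent-insert D-indep (λ (Cy , y-near) → not-adj-across Cy y-near) ,
      betweenFree⇒IsMV (betweenFree-insert D-free u-outside after-u)
      where
        D : V → Set
        D x = C x × Nearer v u x

        D-free : BetweenFree D
        D-free (Cx , _) (Cy , _) (Cz , _) = C-free Cx Cy Cz

        D-indep : Independent G D
        D-indep x y (Cx , x-near) (Cy , y-near) xy with edge-sides xy v
        ... | inj₁ v-near = unstacked (x , y , Cx , Cy , x-near , adj⇒≢ xy ,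
                                       between-sym (edge-between xy v-near))
        ... | inj₂ v-near = unstacked (y , x , Cy , Cx , y-near , adj⇒≢ xy ∘ sym ,
                                       between-sym (edge-between (adj-sym G xy) v-near))

        u-outside : D x → D y → ¬ Between x u y
        u-outside (_ , x-near) (_ , y-near) = not-between-beyond (adj⇒≢ uv)
          (edge-between (adj-sym G uv) x-near) (edge-between (adj-sym G uv) y-near)

        after-u : D z → D y → Between u z y → z ≡ y
        after-u {z} {y} (Cz , z-near) (Cy , y-near) uzy with z ≟ᶠ y
        ... | yes z≡y = z≡y
        ... | no z≢y  = ⊥-elim (unstacked (z , y , Cz , Cy , z-near , z≢y , suc-injective (begin
          suc (dist v z + dist z y)  ≡⟨ cong (_+ dist z y) (nearer-sym z-near) ⟨
          dist u z + dist z y        ≡⟨ uzy ⟩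
          dist u y                   ≡⟨ nearer-sym y-near ⟩
          suc (dist v y)             ∎)))
          where open ≡-Reasoning

    module _ {p q} (Cp : C p) (Cq : C q) (p-near : Nearer v u p) (p≢q : p ≢ q) (vpq : Between v p q) where

      v≢p : v ≢ p
      v≢p refl = v∉C Cp

      C-beyond-p : C e → Between v p e
      C-beyond-p {e} Ce with dist v p + dist p e ≟ dist v e
      ... | yes vpe = vpe
      ... | no ¬vpe = [ ⊥-elim ∘ p≢q , (λ { refl → vpp }) ] (C-free Cq Ce Cp (median v≢p vpq ¬vpe))
        where
          vpp : Between v p p
          vpp = trans (cong (dist v p +_) (dist-refl p)) (+-identityʳ _)

      stacked-pair-IMV : IsIMV G (λ x → x ≡ u ⊎ x ≡ p)
      stacked-pair-IMV =
        independent-insert (λ { _ _ refl refl → adj-irrefl G }) (λ { refl → not-adj-across Cp p-near }) ,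
        betweenFree⇒IsMV pair-betweenFree

      stacked-rest-IMV : IsIMV G (λ x → x ≡ v ⊎ (C x × x ≢ p))
      stacked-rest-IMV =
        independent-insert D-indep v-apart ,
        betweenFree⇒IsMV (betweenFree-insert D-free v-outside after-v)
        where
          D : V → Set
          D x = C x × x ≢ p

          D-free : BetweenFree D
          D-free (Cx , _) (Cy , _) (Cz , _) = C-free Cx Cy Cz

          D-indep : Independent G D
          D-indep x y (Cx , x≢p) (Cy , y≢p) xy =
            [ x≢p ∘ sym , y≢p ∘ sym ] (betweenFree-edge C-free xy Cx Cy Cp)

          v-apart : D y → ¬ Adj G v y
          v-apart (Cy , y≢p) vy = [ v≢p ∘ sym , y≢p ∘ sym ] (between-adjacent vy (C-beyond-p Cy))

          v-outside : D x → D y → ¬ Between x v y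
          v-outside (Cx , _) (Cy , _) = not-between-beyond v≢p (C-beyond-p Cx) (C-beyond-p Cy)

          after-v : D z → D y → Between v z y → z ≡ y
          after-v {z} {y} (Cz , z≢p) (Cy , _) vzy = [ ⊥-elim ∘ z≢p , id ] (C-free Cp Cy Cz pzy)
            where
              open ≡-Reasoning
              pzy : Between p z y
              pzy = +-cancelˡ-≡ (dist v p) _ _ (begin
                dist v p + (dist p z + dist z y)  ≡⟨ +-assoc (dist v p) (dist p z) (dist z y) ⟨
                dist v p + dist p z + dist z y    ≡⟨ cong (_+ dist z y) (C-beyond-p Cz) ⟩
                dist v z + dist z y               ≡⟨ vzy ⟩
                dist v y                          ≡⟨ C-beyond-p Cy ⟨
                dist v p + dist p y               ∎)

  module _ {l} (c : V → Fin l) (c-MV : ∀ k → IsMV G (Class G c k)) {i j : Fin l} (i≢j : i ≢ j) where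
    private
      C : V → Set
      C = Class G c j

      C? : Decidable C
      C? x = c x ≟ᶠ j

      C-free : BetweenFree C
      C-free = IsMV⇒betweenFree (c-MV j)

      colour-i∉C : c x ≡ i → ¬ C x
      colour-i∉C cx≡i cx≡j = i≢j (trans (sym cx≡i) cx≡j)

      class-i-edge : Adj G u v → c u ≡ i → c v ≡ i → c x ≡ i → x ≡ u ⊎ x ≡ v
      class-i-edge = betweenFree-edge (IsMV⇒betweenFree (c-MV i))

    stacked? : ∀ u v → Dec (Stacked u v C)
    stacked? u v = any? λ p → any? λ q → C? p ×-dec C? q ×-dec dist p u ≟ suc (dist p v) ×-dec
                                          ¬? (p ≟ᶠ q) ×-dec dist v p + dist p q ≟ dist v q

    repair-stacked : Adj G u v → c u ≡ i → c v ≡ i → Stacked u v C → Repair G c i j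
    repair-stacked {u} {v} uv cu cv (p , q , Cp , Cq , p-near , p≢q , vpq) =
      Recolouring.repair G c i≢j P? Q? covers (stacked-pair-IMV uv C-free v∉C Cp Cq p-near p≢q vpq)
                                              (stacked-rest-IMV uv C-free v∉C Cp Cq p-near p≢q vpq)
      where
        v∉C = colour-i∉C cv
        P? : Decidable (λ x → x ≡ u ⊎ x ≡ p)
        P? x = x ≟ᶠ u ⊎-dec x ≟ᶠ p
        Q? : Decidable (λ x → x ≡ v ⊎ (C x × x ≢ p))
        Q? x = x ≟ᶠ v ⊎-dec C? x ×-dec ¬? (x ≟ᶠ p)
        covers : c x ≡ i ⊎ c x ≡ j → (x ≡ u ⊎ x ≡ p) ⊎ (x ≡ v ⊎ (C x × x ≢ p))
        covers (inj₁ cx≡i) = [ inj₁ ∘ inj₁ , inj₂ ∘ inj₁ ] (class-i-edge uv cu cv cx≡i)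
        covers {x} (inj₂ cx≡j) with x ≟ᶠ p
        ... | yes x≡p = inj₁ (inj₂ x≡p)
        ... | no x≢p  = inj₂ (inj₂ (cx≡j , x≢p))

    repair : Adj G u v → c u ≡ i → c v ≡ i → Repair G c i j
    repair {u} {v} uv cu cv with stacked? u v | stacked? v u
    ... | yes s  | _      = repair-stacked uv cu cv s
    ... | no _   | yes s  = repair-stacked (adj-sym G uv) cv cu s
    ... | no ¬s  | no ¬s′ = Recolouring.repair G c i≢j P? Q? covers
                              (nearer-part-IMV uv C-free (colour-i∉C cv) ¬s)
                              (nearer-part-IMV (adj-sym G uv) C-free (colour-i∉C cu) ¬s′)
      where
        P? : Decidable (λ x → x ≡ u ⊎ (C x × Nearer v u x))
        P? x = x ≟ᶠ u ⊎-dec C? x ×-dec dist x u ≟ suc (dist x v)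
        Q? : Decidable (λ x → x ≡ v ⊎ (C x × Nearer u v x))
        Q? x = x ≟ᶠ v ⊎-dec C? x ×-dec dist x v ≟ suc (dist x u)
        covers : c x ≡ i ⊎ c x ≡ j →
                 (x ≡ u ⊎ (C x × Nearer v u x)) ⊎ (x ≡ v ⊎ (C x × Nearer u v x))
        covers (inj₁ cx≡i) = [ inj₁ ∘ inj₁ , inj₂ ∘ inj₁ ] (class-i-edge uv cu cv cx≡i)
        covers {x} (inj₂ cx≡j) = [ (λ x-near → inj₂ (inj₂ (cx≡j , x-near)))
                                 , (λ x-near → inj₁ (inj₂ (cx≡j , x-near))) ] (edge-sides uv x)

  record ClassFixed {l} (c : V → Fin l) (i : Fin l) : Set where
    field
      colouring         : V → Fin l
      all-MV            : ∀ k → IsMV G (Class G colouring k)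
      class-independent : Independent G (Class G colouring i)
      keeps-independent : ∀ {k} → k ≢ i → Independent G (Class G c k) →
                          Independent G (Class G colouring k)

  fix-edge : ∀ {l} → 3 ≤ n → (c : V → Fin l) → (∀ k → IsMV G (Class G c k)) →
             ∀ {i} → Adj G u v → c u ≡ i → c v ≡ i → ClassFixed c i
  fix-edge {u} {v} three c c-MV {i} uv cu cv = record
    { colouring         = colouring
    ; all-MV            = all-MV
    ; class-independent = proj₁ class-i-IMV
    ; keeps-independent = keeps-independent
    }
    where
      third = ∃-avoiding-two three u v
      j = c (proj₁ third)

      i≢j : i ≢ j
      i≢j i≡j = [ proj₁ (proj₂ third) , proj₂ (proj₂ third) ]
                  (betweenFree-edge (IsMV⇒betweenFree (c-MV i)) uv cu cv (sym i≡j))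

      open Repair (repair c c-MV i≢j uv cu cv)

      all-MV : ∀ k → IsMV G (Class G colouring k)
      all-MV k with k ≟ᶠ i | k ≟ᶠ j
      ... | yes refl | _        = proj₂ class-i-IMV
      ... | no _     | yes refl = proj₂ class-j-IMV
      ... | no k≢i   | no k≢j   = IsMV-⊆ G (other-classes-shrink k≢i k≢j) (c-MV k)

      keeps-independent : ∀ {k} → k ≢ i → Independent G (Class G c k) →
                          Independent G (Class G colouring k)
      keeps-independent {k} k≢i k-indep with k ≟ᶠ j
      ... | yes refl = proj₁ class-j-IMV
      ... | no k≢j   = Independent-⊆ G (other-classes-shrink k≢i k≢j) k-indep

  fix-class : ∀ {l} → 3 ≤ n → (c : V → Fin l) → (∀ k → IsMV G (Class G c k)) →
              ∀ i → ClassFixed c i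
  fix-class three c c-MV i
    with any? (λ u → any? λ v → c u ≟ᶠ i ×-dec c v ≟ᶠ i ×-dec dist u v ≟ 1)
  ... | yes (u , v , cu , cv , uv≡1) = fix-edge three c c-MV (dist≡1⇒adj uv≡1) cu cv
  ... | no no-edge = record
    { colouring         = c
    ; all-MV            = c-MV
    ; class-independent = λ x y cx cy xy → no-edge (x , y , cx , cy , adj⇒dist≡1 xy)
    ; keeps-independent = λ _ → id
    }

  mv⇒imv-partition : ∀ {l} → 3 ≤ n → PartitionInto G (IsMV G) l → PartitionInto G (IsIMV G) l
  mv⇒imv-partition {l} three (c , c-MV) =
    let c′ , c′-MV , c′-independent = fix-below l ≤-refl in
    c′ , λ k → c′-independent k (toℕ<n k) , c′-MV k
    where
      fix-below : ∀ m → m ≤ l → Σ (V → Fin l) λ c′ →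
                  (∀ k → IsMV G (Class G c′ k)) × (∀ k → toℕ k < m → Independent G (Class G c′ k))
      fix-below zero    _   = c , c-MV , λ _ ()
      fix-below (suc m) m<l with fix-below m (<⇒≤ m<l)
      ... | c′ , c′-MV , c′-independent = colouring , all-MV , independent
        where
          open ClassFixed (fix-class three c′ c′-MV (fromℕ< m<l))
          independent : ∀ k → toℕ k < suc m → Independent G (Class G colouring k)
          independent k k<1+m with k ≟ᶠ fromℕ< m<l
          ... | yes refl = class-independent
          ... | no k≢m   = keeps-independent k≢m (c′-independent k (≤∧≢⇒< (s≤s⁻¹ k<1+m) k≢m′))
            where
              k≢m′ : toℕ k ≢ m
              k≢m′ k≡m = k≢m (toℕ-injective (trans k≡m (sym (toℕ-fromℕ< m<l))))

theorem4p7 : ∀ (n : ℕ) (T : Graph n) → 3 ≤ n → IsTree T →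
             ∀ (k l : ℕ) → IsChiMuI T k → IsChiMu T l → k ≡ l
theorem4p7 n T three (connected , acyclic) k l ((c , c-IMV) , k-least) (l-partition , l-least) =
  ≤-antisym (≮⇒≥ λ l<k → k-least l l<k (mv⇒imv-partition three l-partition))
            (≮⇒≥ λ k<l → l-least k k<l (c , proj₂ ∘ c-IMV))
  where open TreeMetric T connected acyclic
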